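{- Let $k\ge3$ be an odd integer, and let $A$ be a $k$-diagonal array of size $n>k$ with width $s=\frac{n-k}{2}$, written in standard form. If $\gcd(n,k-2)=1$, then $R=(1,\dots,1)$ and $C=(-1,1,\dots,1)$ are a solution of $P(A)$.
   Context: Arrays are toroidal: an $n\times n$ array has rows and columns indexed modulo $n$ (representatives $1,\dots,n$). Each cell is filled or empty; $F(A)$ is the set of filled cells. For $(i,j)\in F(A)$: - the row successor $s_r((i,j))$ is $(i,j+k)$ with $k\ge1$ minimal such that $(i,j+k)\in F(A)$; - the column successor $s_c((i,j))$ is $(i+k,j)$ with $k\ge1$ minimal such that $(i+k,j)\in F(A)$. Given $R,C\in\{ -1,1\}^n$, the move function is $S_{R,C}((i,j))=s_c^{\,c_{j'}}((i,j'))$, where $(i,j')=s_r^{\,r_i}((i,j))$; exponent $-1$ means inverse. $R,C$ is a solution of $P(A)$ if $S_{R,C}$ is a single cycle on $F(A)$. Diagonals: $D_i=\{(i+t-1,t):t=1,\dots,n\}$, with row indices modulo $n$. A square array of size $n\ge k$ is $k$-diagonal if its filled cells are exactly those of $k$ distinct diagonals. Empty strips and width: an empty strip of width $t$ is a set $\{D_{r+1},\dots,D_{r+t}\}$ of empty diagonals with $D_r$ and $D_{r+t+1}$ filled (indices modulo $n$). The array has width $s$ if all its empty strips have width $s$. Standard form: the array is in standard form if $D_1$ is filled and $D_n$ is empty. -}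

module Defs where

open import Data.Nat using (ℕ; zero; suc; _+_; _*_; _∸_; _≤_; NonZero)
open import Data.Nat.DivMod using (_%_; m%n<n)
open import Data.Fin using (Fin; toℕ; fromℕ<)
open import Data.Bool using (Bool; true; false; if_then_else_)
open import Data.Product using (_×_; _,_; ∃; proj₁; proj₂)
open import Data.Sign using (Sign)
open import Data.Fin.Subset using (Subset; ∣_∣)
open import Data.Vec using (lookup)
open import Relation.Binary.PropositionalEquality using (_≡_)

Odd : ℕ → Set
Odd k = ∃ λ m → k ≡ 2 * m + 1

-- An n×n toroidal array. Indices are 0-based: paper row/column i ↔ Fin value i-1.
-- A i j ≡ true means the cell (i , j) is filled.
Array : ℕ → Set
Array n = Fin n → Fin n → Bool

Cell : ℕ → Set
Cell n = Fin n × Fin n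

iterate : {X : Set} → (X → X) → ℕ → X → X
iterate f zero x = x
iterate f (suc m) x = f (iterate f m x)

search : (ℕ → Bool) → ℕ → ℕ → ℕ
search f zero k = k
search f (suc fuel) k = if f k then k else search f fuel (suc k)

leastPos : ℕ → (ℕ → Bool) → ℕ
leastPos n f = search f n 1

module _ {n : ℕ} .{{_ : NonZero n}} where

  toF : ℕ → Fin n
  toF m = fromℕ< (m%n<n m n)

  _⊕_ : Fin n → ℕ → Fin n
  i ⊕ m = toF (toℕ i + m)

  _⊖_ : Fin n → ℕ → Fin n
  i ⊖ m = toF (toℕ i + (n ∸ (m % n)))

  Filled : Array n → Cell n → Set
  Filled A (i , j) = A i j ≡ true

  rowSucc : Array n → Cell n → Cell n
  rowSucc A (i , j) = (i , j ⊕ leastPos n (λ m → A i (j ⊕ m)))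

  rowPred : Array n → Cell n → Cell n
  rowPred A (i , j) = (i , j ⊖ leastPos n (λ m → A i (j ⊖ m)))

  colSucc : Array n → Cell n → Cell n
  colSucc A (i , j) = (i ⊕ leastPos n (λ m → A (i ⊕ m) j) , j)

  colPred : Array n → Cell n → Cell n
  colPred A (i , j) = (i ⊖ leastPos n (λ m → A (i ⊖ m) j) , j)

  -- f^{+1} = f, f^{-1} = g (g the inverse of f on filled cells)
  signed : Sign → (Cell n → Cell n) → (Cell n → Cell n) → Cell n → Cell n
  signed Sign.+ f g = f
  signed Sign.- f g = g

  move : Array n → (Fin n → Sign) → (Fin n → Sign) → Cell n → Cell n
  move A R C x =
    let y = signed (R (proj₁ x)) (rowSucc A) (rowPred A) x
    in signed (C (proj₂ y)) (colSucc A) (colPred A) y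

  -- R , C is a solution of P(A): S_{R,C} is a single cycle on F(A)
  IsSolution : Array n → (Fin n → Sign) → (Fin n → Sign) → Set
  IsSolution A R C =
    ∀ x y → Filled A x → Filled A y → ∃ λ m → iterate (move A R C) m x ≡ y

  -- Diagonals: 0-based diagonal d is the paper's D_{d+1} = {(d + t , t)}
  DiagFilled : Array n → Fin n → Set
  DiagFilled A d = ∀ (t : Fin n) → A (d ⊕ toℕ t) t ≡ true

  DiagEmpty : Array n → Fin n → Set
  DiagEmpty A d = ∀ (t : Fin n) → A (d ⊕ toℕ t) t ≡ false

  KDiagonal : ℕ → Array n → Set
  KDiagonal k A = ∃ λ (D : Subset n) →
    ∣ D ∣ ≡ k × (∀ (d t : Fin n) → A (d ⊕ toℕ t) t ≡ lookup D d)

  HasWidth : ℕ → Array n → Set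
  HasWidth s A = ∀ (r : Fin n) (t : ℕ) → 1 ≤ t →
    DiagFilled A r →
    (∀ u → 1 ≤ u → u ≤ t → DiagEmpty A (r ⊕ u)) →
    DiagFilled A (r ⊕ suc t) →
    t ≡ s

  StandardForm : Array n → Set
  StandardForm A = DiagFilled A (toF 0) × DiagEmpty A (toF (n ∸ 1))

allPlus : {n : ℕ} → Fin n → Sign
allPlus _ = Sign.+

firstMinus : {n : ℕ} → Fin n → Sign
firstMinus Fin.zero = Sign.-
firstMinus (Fin.suc _) = Sign.+

-- Write cell d j for the cell of diagonal d (read modulo n) in column j, gap d for the
-- distance from a filled diagonal d down to the next filled one, and prev d = d - gap d.
-- As filled cells form whole diagonals, the move S takes cell d j to cell d (j + gap d),
-- unless it lands in column 0, where C reverses the column step and S drops to column 0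
-- of prev (prev d).  By the width hypothesis every gap is 1 or s + 1, and
-- n = 2(s + 1) + (k - 2) makes s + 1 coprime to n, so S runs through all n cells of a
-- diagonal before it leaves it.  On the k filled diagonals prev is a single k-cycle
-- (seen by descending once around the torus and counting), so for odd k its square is
-- still one cycle and S connects any two filled cells.
module Submission where

open import Defs
open import Data.Bool using (Bool; true; false)
open import Data.Empty using (⊥; ⊥-elim)
open import Data.Fin as Fin using (Fin; toℕ)
import Data.Fin.Properties as FinP
open import Data.Fin.Subset using (Subset; ∣_∣)
open import Data.Nat
open import Data.Nat.Coprimality as Coprimality using (Coprime; coprime-divisor; coprime-Bézout; 1-coprimeTo)
open import Data.Nat.Divisibility using (_∣_; ∣⇒≤; m%n≡0⇒n∣m; ∣1⇒≡1; ∣m+n∣m⇒∣n; ∣n⇒∣m*n)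
open import Data.Nat.DivMod
open import Data.Nat.GCD using (gcd; gcd-greatest; module Bézout)
open import Data.Nat.Induction using (<-rec)
open import Data.Nat.Properties
open import Data.Nat.Tactic.RingSolver using (solve-∀)
open import Data.Product using (_×_; _,_; ∃; proj₂)
open import Data.Sign using (Sign)
open import Data.Sum using (_⊎_; inj₁; inj₂)
open import Data.Vec using (Vec; []; _∷_; lookup)
open import Relation.Binary.PropositionalEquality
open import Relation.Nullary using (yes; no)

hit-miss : ∀ {b} → b ≡ true → b ≡ false → ⊥
hit-miss refl ()

record FirstHit (f : ℕ → Bool) (k w L : ℕ) : Set where
  field
    lo   : k ≤ L
    hi   : L ≤ w
    hit  : f L ≡ true
    miss : ∀ m → k ≤ m → m < L → f m ≡ false

search-firstHit : ∀ f fuel k w → k ≤ w → w < k + fuel → f w ≡ true →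
                  FirstHit f k w (search f fuel k)
search-firstHit f zero k w k≤w w<k+0 fw =
  ⊥-elim (<⇒≱ (subst (w <_) (+-identityʳ k) w<k+0) k≤w)
search-firstHit f (suc fuel) k w k≤w w<k+fuel fw with f k in fk
... | true = record { lo = ≤-refl ; hi = k≤w ; hit = fk
                    ; miss = λ m k≤m m<k → ⊥-elim (<⇒≱ m<k k≤m) }
... | false with m≤n⇒m<n∨m≡n k≤w
...   | inj₂ refl = ⊥-elim (hit-miss fw fk)
...   | inj₁ k<w = record { lo = ≤-trans (n≤1+n k) lo ; hi = hi ; hit = hit ; miss = miss′ }
  where
  open FirstHit (search-firstHit f fuel (suc k) w k<w (subst (w <_) (+-suc k fuel) w<k+fuel) fw)
  miss′ : ∀ m → k ≤ m → m < search f fuel (suc k) → f m ≡ false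
  miss′ m k≤m m<L with m≤n⇒m<n∨m≡n k≤m
  ... | inj₁ k<m = miss m k<m m<L
  ... | inj₂ refl = fk

search-unique : ∀ f fuel k L → k ≤ L → L < k + fuel → f L ≡ true →
                (∀ m → k ≤ m → m < L → f m ≡ false) → search f fuel k ≡ L
search-unique f fuel k L k≤L L<k+fuel fL before =
  ≤-antisym hi (≮⇒≥ λ S<L → hit-miss hit (before _ lo S<L))
  where open FirstHit (search-firstHit f fuel k L k≤L L<k+fuel fL)

search-cong : ∀ {f g : ℕ → Bool} → (∀ m → f m ≡ g m) → ∀ fuel k → search f fuel k ≡ search g fuel k
search-cong f≗g zero k = refl
search-cong {g = g} f≗g (suc fuel) k rewrite f≗g k with g k
... | true = refl
... | false = search-cong f≗g fuel (suc k)

iterate-+ : ∀ {X : Set} (f : X → X) a b x → iterate f (a + b) x ≡ iterate f a (iterate f b x)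
iterate-+ f zero b x = refl
iterate-+ f (suc a) b x = cong f (iterate-+ f a b x)

iterate-pres : ∀ {X : Set} (P : X → Set) (f : X → X) → (∀ {x} → P x → P (f x)) →
               ∀ m {x} → P x → P (iterate f m x)
iterate-pres P f step zero px = px
iterate-pres P f step (suc m) px = step (iterate-pres P f step m px)

iterate-resp : ∀ {X : Set} (R : X → X → Set) (f : X → X) → (∀ {x y} → R x y → R (f x) (f y)) →
               ∀ m {x y} → R x y → R (iterate f m x) (iterate f m y)
iterate-resp R f step zero rxy = rxy
iterate-resp R f step (suc m) rxy = step (iterate-resp R f step m rxy)

even-or-odd : ∀ m → (∃ λ t → m ≡ t + t) ⊎ (∃ λ t → suc m ≡ t + t)
even-or-odd zero = inj₁ (0 , refl)
even-or-odd (suc m) with even-or-odd m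
... | inj₁ (t , m≡2t) = inj₂ (suc t , cong suc (trans (cong suc m≡2t) (sym (+-suc t t))))
... | inj₂ (t , 1+m≡2t) = inj₁ (t , 1+m≡2t)

sumℕ : ℕ → (ℕ → ℕ) → ℕ
sumℕ zero f = 0
sumℕ (suc c) f = sumℕ c f + f c

sum-ext : ∀ c {f g : ℕ → ℕ} → (∀ v → v < c → f v ≡ g v) → sumℕ c f ≡ sumℕ c g
sum-ext zero f≗g = refl
sum-ext (suc c) f≗g = cong₂ _+_ (sum-ext c (λ v v<c → f≗g v (m<n⇒m<1+n v<c))) (f≗g c ≤-refl)

sum-front : ∀ b (f : ℕ → ℕ) → sumℕ (suc b) f ≡ f 0 + sumℕ b (λ r → f (suc r))
sum-front zero f = +-comm 0 (f 0)
sum-front (suc b) f = trans (cong (_+ f (suc b)) (sum-front b f)) (+-assoc (f 0) _ _)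

sum-split : ∀ a b (f : ℕ → ℕ) → sumℕ (a + b) f ≡ sumℕ a f + sumℕ b (λ r → f (a + r))
sum-split a zero f = trans (cong (λ x → sumℕ x f) (+-identityʳ a)) (sym (+-identityʳ _))
sum-split a (suc b) f = trans (cong (λ x → sumℕ x f) (+-suc a b))
  (trans (cong (_+ f (a + b)) (sum-split a b f)) (+-assoc (sumℕ a f) _ _))

sum-lone-first : ∀ b (f : ℕ → ℕ) → f 0 ≡ 1 → (∀ r → r < b → f (suc r) ≡ 0) → sumℕ (suc b) f ≡ 1
sum-lone-first b f f0≡1 rest≡0 = trans (sum-front b f) (cong₂ _+_ f0≡1 (zeros b rest≡0))
  where
  zeros : ∀ c → (∀ r → r < c → f (suc r) ≡ 0) → sumℕ c (λ r → f (suc r)) ≡ 0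
  zeros zero _ = refl
  zeros (suc c) z = cong₂ _+_ (zeros c (λ r r<c → z r (m<n⇒m<1+n r<c))) (z c ≤-refl)

sum-reflect : ∀ c (g : ℕ → ℕ) → g c ≡ g 0 → sumℕ c (λ u → g (c ∸ u)) ≡ sumℕ c g
sum-reflect c g gc≡g0 = trans (reverse c) (+-cancelˡ-≡ (g 0) _ _ rotate)
  where
  reverse : ∀ c → sumℕ c (λ u → g (c ∸ u)) ≡ sumℕ c (λ v → g (suc v))
  reverse zero = refl
  reverse (suc c) = trans (sum-front c (λ u → g (suc c ∸ u)))
    (trans (cong (g (suc c) +_) (reverse c)) (+-comm (g (suc c)) _))
  rotate : g 0 + sumℕ c (λ v → g (suc v)) ≡ g 0 + sumℕ c g
  rotate = trans (sym (sum-front c g)) (trans (cong (sumℕ c g +_) gc≡g0) (+-comm (sumℕ c g) (g 0)))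

bit : Bool → ℕ
bit true = 1
bit false = 0

lookupℕ : ∀ {m} → Vec Bool m → ℕ → Bool
lookupℕ [] v = false
lookupℕ (x ∷ xs) zero = x
lookupℕ (x ∷ xs) (suc v) = lookupℕ xs v

lookupℕ-toℕ : ∀ {m} (V : Vec Bool m) (i : Fin m) → lookupℕ V (toℕ i) ≡ lookup V i
lookupℕ-toℕ (x ∷ xs) Fin.zero = refl
lookupℕ-toℕ (x ∷ xs) (Fin.suc i) = lookupℕ-toℕ xs i

size-sum : ∀ {m} (V : Subset m) → ∣ V ∣ ≡ sumℕ m (λ v → bit (lookupℕ V v))
size-sum [] = refl
size-sum {suc m} (true ∷ xs) =
  trans (cong suc (size-sum xs)) (sym (sum-front m (λ v → bit (lookupℕ (true ∷ xs) v))))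
size-sum {suc m} (false ∷ xs) =
  trans (size-sum xs) (sym (sum-front m (λ v → bit (lookupℕ (false ∷ xs) v))))

module Modular (n : ℕ) .{{_ : NonZero n}} where

  infix 4 _≋_
  _≋_ : ℕ → ℕ → Set
  a ≋ b = a % n ≡ b % n

  ≋-+ : ∀ {a a′ b b′} → a ≋ a′ → b ≋ b′ → a + b ≋ a′ + b′
  ≋-+ {a} {a′} {b} {b′} p q = begin
    (a + b) % n               ≡⟨ %-distribˡ-+ a b n ⟩
    (a % n + b % n) % n       ≡⟨ cong₂ (λ x y → (x + y) % n) p q ⟩
    (a′ % n + b′ % n) % n     ≡⟨ %-distribˡ-+ a′ b′ n ⟨
    (a′ + b′) % n             ∎
    where open ≡-Reasoning

  ≋-* : ∀ {a a′ b b′} → a ≋ a′ → b ≋ b′ → a * b ≋ a′ * b′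
  ≋-* {a} {a′} {b} {b′} p q = begin
    (a * b) % n               ≡⟨ %-distribˡ-* a b n ⟩
    (a % n * (b % n)) % n     ≡⟨ cong₂ (λ x y → (x * y) % n) p q ⟩
    (a′ % n * (b′ % n)) % n   ≡⟨ %-distribˡ-* a′ b′ n ⟨
    (a′ * b′) % n             ∎
    where open ≡-Reasoning

  %≋ : ∀ a → a % n ≋ a
  %≋ a = m%n%n≡m%n a n

  +n≋ : ∀ a → a + n ≋ a
  +n≋ a = [m+n]%n≡m%n a n

  0%n : 0 % n ≡ 0
  0%n = m<n⇒m%n≡m (>-nonZero⁻¹ n)

  n≋0 : n ≋ 0
  n≋0 = trans (n%n≡0 n) (sym 0%n)

  +≋0 : ∀ a {b} → b ≋ 0 → a + b ≋ a
  +≋0 a b≋0 = trans (≋-+ {a} {a} refl b≋0) (cong (_% n) (+-identityʳ a))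

  neg≋ : ∀ a → a + (n ∸ a % n) ≋ 0
  neg≋ a = begin
    (a + (n ∸ a % n)) % n       ≡⟨ ≋-+ (sym (%≋ a)) refl ⟩
    (a % n + (n ∸ a % n)) % n   ≡⟨ cong (_% n) (m+[n∸m]≡n (m%n≤n a n)) ⟩
    n % n                       ≡⟨ n≋0 ⟩
    0 % n                       ∎
    where open ≡-Reasoning

  ≋-cancelˡ : ∀ a {b c} → a + b ≋ a + c → b ≋ c
  ≋-cancelˡ a {b} {c} ab≋ac = begin
    b % n                       ≡⟨ +≋0 b (neg≋ a) ⟨
    (b + (a + a⁻)) % n          ≡⟨ cong (_% n) (swap b a a⁻) ⟩
    (a + b + a⁻) % n            ≡⟨ ≋-+ ab≋ac refl ⟩
    (a + c + a⁻) % n            ≡⟨ cong (_% n) (swap c a a⁻) ⟨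
    (c + (a + a⁻)) % n          ≡⟨ +≋0 c (neg≋ a) ⟩
    c % n                       ∎
    where
    open ≡-Reasoning
    a⁻ = n ∸ a % n
    swap : ∀ x y z → x + (y + z) ≡ y + x + z
    swap = solve-∀

  -- d - m for m ≤ n, kept in ℕ by adding n.
  down : ℕ → ℕ → ℕ
  down d m = d + (n ∸ m)

  down-+ : ∀ d {m} → m ≤ n → down d m + m ≋ d
  down-+ d {m} m≤n = trans (cong (_% n) (trans (+-assoc d (n ∸ m) m) (cong (d +_) (m∸n+n≡m m≤n))))
                           (+n≋ d)

  down-∸ : ∀ d {g u} → g ≤ n → u ≤ g → down d g + u ≡ down d (g ∸ u)
  down-∸ d {g} {u} g≤n u≤g = begin
    d + (n ∸ g) + u      ≡⟨ +-assoc d (n ∸ g) u ⟩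
    d + ((n ∸ g) + u)    ≡⟨ cong (d +_) (sym (m+n∸n≡m ((n ∸ g) + u) (g ∸ u))) ⟩
    d + ((n ∸ g) + u + (g ∸ u) ∸ (g ∸ u))   ≡⟨ cong (λ t → d + (t ∸ (g ∸ u))) total ⟩
    d + (n ∸ (g ∸ u))    ∎
    where
    open ≡-Reasoning
    total : (n ∸ g) + u + (g ∸ u) ≡ n
    total = trans (+-assoc (n ∸ g) u (g ∸ u))
                  (trans (cong ((n ∸ g) +_) (m+[n∸m]≡n u≤g)) (m∸n+n≡m g≤n))

  -- If x stands for -c, then -(c + r) stands for x - r.
  down-shift : ∀ {x c} r → x + c ≋ 0 → c + r ≤ n → down 0 (c + r) ≋ down x r
  down-shift {x} {c} r x+c≋0 c+r≤n = ≋-cancelˡ c (begin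
    (c + (n ∸ (c + r))) % n     ≡⟨ cong (_% n) c-cr ⟩
    (n ∸ r) % n                 ≡⟨ ≋-+ x+c≋0 refl ⟨
    (x + c + (n ∸ r)) % n       ≡⟨ cong (_% n) (shuffle x c (n ∸ r)) ⟩
    (c + (x + (n ∸ r))) % n     ∎)
    where
    open ≡-Reasoning
    shuffle : ∀ x c w → x + c + w ≡ c + (x + w)
    shuffle = solve-∀
    regroup : ∀ c r w → c + w + r ≡ c + r + w
    regroup = solve-∀
    c-cr : c + (n ∸ (c + r)) ≡ n ∸ r
    c-cr = trans (sym (m+n∸n≡m (c + (n ∸ (c + r))) r))
                 (cong (_∸ r) (trans (regroup c r (n ∸ (c + r))) (m+[n∸m]≡n c+r≤n)))

  toF-≋ : ∀ {a b} → a ≋ b → toF {n} a ≡ toF b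
  toF-≋ {a} {b} a≋b = FinP.fromℕ<-cong (a % n) (b % n) a≋b (m%n<n a n) (m%n<n b n)

  toℕ-toF : ∀ a → toℕ (toF {n} a) ≡ a % n
  toℕ-toF a = FinP.toℕ-fromℕ< (m%n<n a n)

  toF-toℕ : ∀ (i : Fin n) → toF (toℕ i) ≡ i
  toF-toℕ i = FinP.toℕ-injective (trans (toℕ-toF (toℕ i)) (m<n⇒m%n≡m (FinP.toℕ<n i)))

  ⊕-toF : ∀ a m → toF {n} a ⊕ m ≡ toF (a + m)
  ⊕-toF a m = toF-≋ (≋-+ (trans (cong (_% n) (toℕ-toF a)) (%≋ a)) refl)

  ⊖-toF : ∀ a {m} → m ≤ n → toF {n} a ⊖ m ≡ toF (down a m)
  ⊖-toF a {m} m≤n = toF-≋ (≋-+ (trans (cong (_% n) (toℕ-toF a)) (%≋ a)) (n∸m%n≋n∸m m≤n))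
    where
    n∸m%n≋n∸m : ∀ {m} → m ≤ n → n ∸ m % n ≋ n ∸ m
    n∸m%n≋n∸m {m} m≤n with m≤n⇒m<n∨m≡n m≤n
    ... | inj₁ m<n = cong (λ x → (n ∸ x) % n) (m<n⇒m%n≡m m<n)
    ... | inj₂ refl = trans (cong (λ x → (n ∸ x) % n) (n%n≡0 n))
                            (trans n≋0 (cong (_% n) (sym (n∸n≡0 n))))

firstMinus-zero : ∀ {n} (i : Fin n) → toℕ i ≡ 0 → firstMinus i ≡ Sign.-
firstMinus-zero Fin.zero _ = refl

firstMinus-suc : ∀ {n} (i : Fin n) → toℕ i ≢ 0 → firstMinus i ≡ Sign.+
firstMinus-suc Fin.zero i≢0 = ⊥-elim (i≢0 refl)
firstMinus-suc (Fin.suc i) _ = refl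

module DiagonalArray (n : ℕ) .{{_ : NonZero n}} (A : Array n) (D : Subset n)
                     (onDiagonals : ∀ (d t : Fin n) → A (d ⊕ toℕ t) t ≡ lookup D d) where
  open Modular n

  diag : ℕ → Bool
  diag d = lookup D (toF d)

  diag-≋ : ∀ {a b} → a ≋ b → diag a ≡ diag b
  diag-≋ a≋b = cong (lookup D) (toF-≋ a≋b)

  A-on : ∀ {x y} e → e + y ≋ x → A (toF x) (toF y) ≡ diag e
  A-on {x} {y} e e+y≋x = begin
    A (toF x) (toF y)                    ≡⟨ cong (λ i → A i (toF y)) onCell ⟨
    A (toF e ⊕ toℕ (toF {n} y)) (toF y)  ≡⟨ onDiagonals (toF e) (toF y) ⟩
    diag e                               ∎
    where
    open ≡-Reasoning
    onCell : toF e ⊕ toℕ (toF {n} y) ≡ toF x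
    onCell = trans (⊕-toF e _)
      (toF-≋ (trans (≋-+ {e} {e} refl (trans (cong (_% n) (toℕ-toF y)) (%≋ y))) e+y≋x))

  row-right : ∀ {x y} e → e + y ≋ x → ∀ {m} → m ≤ n → A (toF x) (toF y ⊕ m) ≡ diag (down e m)
  row-right {x} {y} e on {m} m≤n = trans (cong (A (toF x)) (⊕-toF y m)) (A-on (down e m) lands)
    where
    shuffle : ∀ a y m → a + (y + m) ≡ a + m + y
    shuffle = solve-∀
    lands : down e m + (y + m) ≋ x
    lands = trans (cong (_% n) (shuffle (down e m) y m)) (trans (≋-+ (down-+ e m≤n) refl) on)

  col-down : ∀ {x y} e → e + y ≋ x → ∀ m → A (toF x ⊕ m) (toF y) ≡ diag (e + m)
  col-down {x} {y} e on m = trans (cong (λ i → A i (toF y)) (⊕-toF x m)) (A-on (e + m) lands)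
    where
    shuffle : ∀ e m y → e + m + y ≡ e + y + m
    shuffle = solve-∀
    lands : e + m + y ≋ x + m
    lands = trans (cong (_% n) (shuffle e m y)) (≋-+ on refl)

  col-up : ∀ {x y} e → e + y ≋ x → ∀ {m} → m ≤ n → A (toF x ⊖ m) (toF y) ≡ diag (down e m)
  col-up {x} {y} e on {m} m≤n = trans (cong (λ i → A i (toF y)) (⊖-toF x m≤n)) (A-on (down e m) lands)
    where
    shuffle : ∀ e m y → e + m + y ≡ e + y + m
    shuffle = solve-∀
    lands : down e m + y ≋ down x m
    lands = trans (cong (_% n) (shuffle e (n ∸ m) y)) (≋-+ on refl)

  gap : ℕ → ℕ
  gap d = leastPos n (λ m → diag (down d m))

  prev : ℕ → ℕ
  prev d = down d (gap d)

  private
    1≤n : 1 ≤ n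
    1≤n = >-nonZero⁻¹ n

  -- Going down n diagonals from a filled d returns to d, so the scan succeeds.
  gap-spec : ∀ {d} → diag d ≡ true → FirstHit (λ m → diag (down d m)) 1 n (gap d)
  gap-spec {d} hd = search-firstHit _ n 1 n 1≤n ≤-refl
    (trans (cong diag (trans (cong (d +_) (n∸n≡0 n)) (+-identityʳ d))) hd)

  gap-least : ∀ {d w} → diag d ≡ true → 1 ≤ w → w ≤ n → diag (down d w) ≡ true → gap d ≤ w
  gap-least {d} {w} hd 1≤w w≤n hw = FirstHit.hi (search-firstHit _ n 1 w 1≤w (s≤s w≤n) hw)

  prev-filled : ∀ {d} → diag d ≡ true → diag (prev d) ≡ true
  prev-filled hd = FirstHit.hit (gap-spec hd)

  scan-down : ∀ (f : ℕ → Bool) {d} → diag d ≡ true →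
              (∀ m → 1 ≤ m → m ≤ n → f m ≡ diag (down d m)) → leastPos n f ≡ gap d
  scan-down f hd sees = search-unique f n 1 _ lo (s≤s hi) (trans (sees _ lo hi) hit)
    (λ m 1≤m m<g → trans (sees m 1≤m (≤-trans (<⇒≤ m<g) hi)) (miss m 1≤m m<g))
    where open FirstHit (gap-spec hd)

  -- Any scan that sees prev d + 1, prev d + 2, … in turn also stops after gap d steps,
  -- since the diagonals strictly between prev d and d are empty.
  scan-up : ∀ (f : ℕ → Bool) {d} → diag d ≡ true →
            (∀ m → f m ≡ diag (prev d + m)) → leastPos n f ≡ gap d
  scan-up f {d} hd sees = search-unique f n 1 _ lo (s≤s hi) (trans (sees _) (trans (diag-≋ (down-+ d hi)) hd))
    (λ m 1≤m m<g → trans (sees m) (trans (cong diag (down-∸ d hi (<⇒≤ m<g)))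
                                   (miss (gap d ∸ m) (m<n⇒0<n∸m m<g) (∸-monoʳ-< 1≤m (<⇒≤ m<g)))))
    where open FirstHit (gap-spec hd)

  cell : ℕ → ℕ → Cell n
  cell d j = (toF (d + j) , toF j)

  cell-≋ : ∀ {d d′ j j′} → d ≋ d′ → j ≋ j′ → cell d j ≡ cell d′ j′
  cell-≋ d≋d′ j≋j′ = cong₂ _,_ (toF-≋ (≋-+ d≋d′ j≋j′)) (toF-≋ j≋j′)

  prev-column : ∀ {d} → diag d ≡ true → ∀ j → prev d + (j + gap d) ≋ d + j
  prev-column {d} hd j =
    trans (cong (_% n) (shuffle (prev d) j (gap d)))
          (≋-+ (down-+ d (FirstHit.hi (gap-spec hd))) refl)
    where
    shuffle : ∀ p j g → p + (j + g) ≡ p + g + j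
    shuffle = solve-∀

  row-step : ∀ {d} j → diag d ≡ true → rowSucc A (cell d j) ≡ (toF (d + j) , toF (j + gap d))
  row-step {d} j hd = cong (toF (d + j) ,_) (trans (cong (toF j ⊕_) scan) (⊕-toF j (gap d)))
    where
    scan : leastPos n (λ m → A (toF (d + j)) (toF j ⊕ m)) ≡ gap d
    scan = scan-down _ hd (λ m _ m≤n → row-right d refl m≤n)

  col-step : ∀ {d} j → diag d ≡ true →
             colSucc A (toF (d + j) , toF (j + gap d)) ≡ cell d (j + gap d)
  col-step {d} j hd = cong (_, toF (j + gap d))
    (trans (cong (toF (d + j) ⊕_) scan)
           (trans (⊕-toF (d + j) (gap d)) (cong toF (+-assoc d j (gap d)))))
    where
    scan : leastPos n (λ m → A (toF (d + j) ⊕ m) (toF (j + gap d))) ≡ gap d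
    scan = scan-up _ hd (col-down (prev d) (prev-column hd j))

  col-back : ∀ {d} j → diag d ≡ true →
             colPred A (toF (d + j) , toF (j + gap d)) ≡ cell (prev (prev d)) (j + gap d)
  col-back {d} j hd = cong (_, toF (j + gap d))
    (trans (cong (toF (d + j) ⊖_) scan) (trans (⊖-toF (d + j) g′≤n) (toF-≋ (sym lands))))
    where
    g′≤n : gap (prev d) ≤ n
    g′≤n = FirstHit.hi (gap-spec (prev-filled hd))
    scan : leastPos n (λ m → A (toF (d + j) ⊖ m) (toF (j + gap d))) ≡ gap (prev d)
    scan = scan-down _ (prev-filled hd) (λ m _ m≤n → col-up (prev d) (prev-column hd j) m≤n)
    shuffle : ∀ p a c → p + a + c ≡ p + c + a
    shuffle = solve-∀
    lands : prev (prev d) + (j + gap d) ≋ down (d + j) (gap (prev d))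
    lands = trans (cong (_% n) (shuffle (prev d) (n ∸ gap (prev d)) (j + gap d)))
                  (≋-+ (prev-column hd j) refl)

  S : Cell n → Cell n
  S = move A allPlus firstMinus

  move-cell : ∀ {d} j → diag d ≡ true →
    S (cell d j) ≡ signed (firstMinus (toF {n} (j + gap d))) (colSucc A) (colPred A)
                          (toF (d + j) , toF (j + gap d))
  move-cell j hd = cong (λ y → signed (firstMinus (proj₂ y)) (colSucc A) (colPred A) y) (row-step j hd)

  move-along : ∀ {d} j → diag d ≡ true → (j + gap d) % n ≢ 0 → S (cell d j) ≡ cell d (j + gap d)
  move-along {d} j hd ≢0 = begin
    S (cell d j)                                  ≡⟨ move-cell j hd ⟩
    column-step (firstMinus (toF (j + gap d)))    ≡⟨ cong column-step plus ⟩
    colSucc A c                                   ≡⟨ col-step j hd ⟩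
    cell d (j + gap d)                            ∎
    where
    open ≡-Reasoning
    c = (toF (d + j) , toF (j + gap d))
    column-step : Sign → Cell n
    column-step σ = signed σ (colSucc A) (colPred A) c
    plus : firstMinus (toF {n} (j + gap d)) ≡ Sign.+
    plus = firstMinus-suc _ (λ ≡0 → ≢0 (trans (sym (toℕ-toF _)) ≡0))

  move-wrap : ∀ {d} j → diag d ≡ true → (j + gap d) % n ≡ 0 →
              S (cell d j) ≡ cell (prev (prev d)) (j + gap d)
  move-wrap {d} j hd ≡0 = begin
    S (cell d j)                                  ≡⟨ move-cell j hd ⟩
    column-step (firstMinus (toF (j + gap d)))    ≡⟨ cong column-step minus ⟩
    colPred A c                                   ≡⟨ col-back j hd ⟩
    cell (prev (prev d)) (j + gap d)              ∎
    where
    open ≡-Reasoning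
    c = (toF (d + j) , toF (j + gap d))
    column-step : Sign → Cell n
    column-step σ = signed σ (colSucc A) (colPred A) c
    minus : firstMinus (toF {n} (j + gap d)) ≡ Sign.-
    minus = firstMinus-zero _ (trans (toℕ-toF _) ≡0)

  Reaches : Cell n → Cell n → Set
  Reaches x y = ∃ λ m → iterate S m x ≡ y

  reaches-trans : ∀ {x y z} → Reaches x y → Reaches y z → Reaches x z
  reaches-trans {x} (m₁ , x→y) (m₂ , y→z) =
    m₂ + m₁ , trans (iterate-+ S m₂ m₁ x) (trans (cong (iterate S m₂) x→y) y→z)

  prev-≋ : ∀ {a b} → a ≋ b → prev a ≋ prev b
  prev-≋ a≋b = ≋-+ a≋b (cong (λ g → (n ∸ g) % n) (search-cong (λ m → diag-≋ (≋-+ a≋b refl)) n 1))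

  iterate-prev-filled : ∀ m {d} → diag d ≡ true → diag (iterate prev m d) ≡ true
  iterate-prev-filled = iterate-pres (λ d → diag d ≡ true) prev prev-filled

  compose-prev : ∀ {a b c} l₁ l₂ → iterate prev l₁ a ≋ b → iterate prev l₂ b ≋ c →
                 iterate prev (l₂ + l₁) a ≋ c
  compose-prev {a} l₁ l₂ a→b b→c =
    trans (cong (_% n) (iterate-+ prev l₂ l₁ a)) (trans (iterate-resp _≋_ prev prev-≋ l₂ a→b) b→c)

  -- Descending from a filled x, prev never jumps over a filled diagonal, so it
  -- reaches the filled e lying δ below x; the recursion is on δ.
  descend-by : ∀ {e} → diag e ≡ true → ∀ δ → δ < n → ∀ {x} → diag x ≡ true → e + δ ≋ x →
               ∃ λ m → iterate prev m x ≋ e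
  descend-by {e} he = <-rec P step
    where
    P : ℕ → Set
    P δ = δ < n → ∀ {x} → diag x ≡ true → e + δ ≋ x → ∃ λ m → iterate prev m x ≋ e
    step : ∀ δ → (∀ {δ′} → δ′ < δ → P δ′) → P δ
    step zero _ _ _ e+0≋x = 0 , sym (trans (cong (_% n) (sym (+-identityʳ e))) e+0≋x)
    step δ@(suc _) ih δ<n {x} hx e+δ≋x =
      let m , done = ih rest<δ (≤-<-trans (m∸n≤m δ g) δ<n) (prev-filled hx) lands
      in m + 1 , trans (cong (_% n) (iterate-+ prev m 1 x)) done
      where
      g = gap x
      g≤n = FirstHit.hi (gap-spec hx)
      e-below-x : down x δ ≋ e
      e-below-x = trans (≋-+ (sym e+δ≋x) refl) (trans (cong (_% n) (+-assoc e δ (n ∸ δ)))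
                        (trans (cong (λ t → (e + t) % n) (m+[n∸m]≡n (<⇒≤ δ<n))) (+n≋ e)))
      g≤δ : g ≤ δ
      g≤δ = gap-least hx (s≤s z≤n) (<⇒≤ δ<n) (trans (diag-≋ e-below-x) he)
      rest<δ : δ ∸ g < δ
      rest<δ = ∸-monoʳ-< (FirstHit.lo (gap-spec hx)) g≤δ
      shuffle : ∀ e a w g → e + a + (w + g) ≡ e + (a + g) + w
      shuffle = solve-∀
      lands : e + (δ ∸ g) ≋ prev x
      lands = begin
        (e + (δ ∸ g)) % n                   ≡⟨ +n≋ _ ⟨
        (e + (δ ∸ g) + n) % n               ≡⟨ cong (λ t → (e + (δ ∸ g) + t) % n) (m∸n+n≡m g≤n) ⟨
        (e + (δ ∸ g) + ((n ∸ g) + g)) % n   ≡⟨ cong (_% n) (shuffle e (δ ∸ g) (n ∸ g) g) ⟩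
        (e + ((δ ∸ g) + g) + (n ∸ g)) % n   ≡⟨ cong (λ t → (e + t + (n ∸ g)) % n) (m∸n+n≡m g≤δ) ⟩
        (e + δ + (n ∸ g)) % n               ≡⟨ ≋-+ e+δ≋x refl ⟩
        (x + (n ∸ g)) % n                   ∎
        where open ≡-Reasoning

  descend : ∀ {x e} → diag x ≡ true → diag e ≡ true → ∃ λ m → iterate prev m x ≋ e
  descend {x} {e} hx he = descend-by he δ (m%n<n _ n) hx e+δ≋x
    where
    δ = (x + (n ∸ e % n)) % n
    shuffle : ∀ e x w → e + (x + w) ≡ x + (e + w)
    shuffle = solve-∀
    e+δ≋x : e + δ ≋ x
    e+δ≋x = trans (≋-+ {e} {e} refl (%≋ _)) (trans (cong (_% n) (shuffle e x _)) (+≋0 x (neg≋ e)))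

  -- With k filled diagonals, diagonal 0 among them, prev has order k on diagonal 0:
  -- descending from 0 passes each filled diagonal exactly once before returning.
  module Counting (k : ℕ) (size : ∣ D ∣ ≡ k) (d0 : diag 0 ≡ true) where

    depth : ℕ → ℕ
    depth zero = 0
    depth (suc m) = depth m + gap (iterate prev m 0)

    passed : ℕ → ℕ
    passed c = sumℕ c (λ u → bit (diag (down 0 u)))

    record Descent (m : ℕ) : Set where
      field
        at     : iterate prev m 0 + depth m ≋ 0
        within : depth m ≤ n
        count  : passed (depth m) ≡ m

    descent-start : Descent 0
    descent-start = record { at = refl ; within = z≤n ; count = refl }

    -- One more step descends by g = gap y past the filled y and g - 1 empty diagonals.
    descent-step : ∀ {m} → Descent m → depth m < n → Descent (suc m)
    descent-step {m} I c<n = record { at = at′ ; within = within′ ; count = count′ }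
      where
      open Descent I
      y = iterate prev m 0
      c = depth m
      hy = iterate-prev-filled m d0
      open FirstHit (gap-spec hy)
      g = gap y
      g≤n-c : g ≤ n ∸ c
      g≤n-c = gap-least hy (m<n⇒0<n∸m c<n) (m∸n≤m n c)
        (trans (diag-≋ (trans (cong (λ t → (y + t) % n) (m∸[m∸n]≡n within)) at)) d0)
      within′ : c + g ≤ n
      within′ = ≤-trans (+-monoʳ-≤ c g≤n-c) (≤-reflexive (m+[n∸m]≡n within))
      shuffle : ∀ y w c g → y + w + (c + g) ≡ y + c + (w + g)
      shuffle = solve-∀
      at′ : prev y + (c + g) ≋ 0
      at′ = trans (cong (_% n) (trans (shuffle y (n ∸ g) c g) (cong (y + c +_) (m∸n+n≡m hi))))
                  (trans (+n≋ (y + c)) at)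
      seen : ∀ r → r ≤ g → diag (down 0 (c + r)) ≡ diag (down y r)
      seen r r≤g = diag-≋ (down-shift r at (≤-trans (+-monoʳ-≤ c r≤g) within′))
      1+[g-1] : suc (g ∸ 1) ≡ g
      1+[g-1] = m+[n∸m]≡n lo
      block : sumℕ g (λ r → bit (diag (down 0 (c + r)))) ≡ 1
      block = subst (λ l → sumℕ l (λ r → bit (diag (down 0 (c + r)))) ≡ 1) 1+[g-1]
        (sum-lone-first (g ∸ 1) _
          (cong bit (trans (seen 0 z≤n) (trans (diag-≋ (+n≋ y)) hy)))
          (λ r r<g-1 → let 1+r<g = subst (suc r <_) 1+[g-1] (s≤s r<g-1) in
             cong bit (trans (seen (suc r) (<⇒≤ 1+r<g)) (miss (suc r) (s≤s z≤n) 1+r<g))))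
      count′ : passed (c + g) ≡ suc m
      count′ = trans (sum-split c g _) (trans (cong₂ _+_ count block) (+-comm m 1))

    descent-complete : ∃ λ M → Descent M × depth M ≡ n
    descent-complete = <-rec P go n refl descent-start
      where
      P : ℕ → Set
      P r = ∀ {m} → n ∸ depth m ≡ r → Descent m → ∃ λ M → Descent M × depth M ≡ n
      go : ∀ r → (∀ {r′} → r′ < r → P r′) → P r
      go _ ih {m} refl I with depth m ≟ n
      ... | yes done = m , I , done
      ... | no short = ih (∸-monoʳ-< deeper (Descent.within next)) refl next
        where
        next = descent-step I (≤∧≢⇒< (Descent.within I) short)
        deeper : depth m < depth (suc m)
        deeper = m<m+n (depth m) (FirstHit.lo (gap-spec (iterate-prev-filled m d0)))

    passed-all : passed n ≡ k
    passed-all = begin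
      sumℕ n (λ u → bit (diag (n ∸ u)))   ≡⟨ sum-reflect n (λ v → bit (diag v)) (cong bit (diag-≋ n≋0)) ⟩
      sumℕ n (λ v → bit (diag v))         ≡⟨ sum-ext n (λ v v<n → cong bit (diag-lookupℕ v v<n)) ⟩
      sumℕ n (λ v → bit (lookupℕ D v))    ≡⟨ size-sum D ⟨
      ∣ D ∣                                ≡⟨ size ⟩
      k                                    ∎
      where
      open ≡-Reasoning
      diag-lookupℕ : ∀ v → v < n → diag v ≡ lookupℕ D v
      diag-lookupℕ v v<n = trans (sym (lookupℕ-toℕ D (toF v)))
                                 (cong (lookupℕ D) (trans (toℕ-toF v) (m<n⇒m%n≡m v<n)))

    prev-order : iterate prev k 0 ≋ 0
    prev-order with descent-complete
    ... | M , I , depth≡n = subst (λ t → iterate prev t 0 ≋ 0) M≡k returns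
      where
      M≡k : M ≡ k
      M≡k = trans (sym (Descent.count I)) (trans (cong passed depth≡n) passed-all)
      returns : iterate prev M 0 ≋ 0
      returns = trans (sym (+n≋ _))
        (trans (cong (λ t → (iterate prev M 0 + t) % n) (sym depth≡n)) (Descent.at I))

    -- For odd k, an even number of prev-steps leads from any filled diagonal to any
    -- other: go through diagonal 0, adding one turn around the cycle if needed.
    even-descent : Odd k → ∀ {d e} → diag d ≡ true → diag e ≡ true →
                   ∃ λ t → iterate prev (t + t) d ≋ e
    even-descent (q , k≡2q+1) {d} {e} hd he with descend hd d0 | descend d0 he
    ... | m₁ , d→0 | m₂ , 0→e with even-or-odd (m₂ + m₁)
    ... | inj₁ (t , even) = t , subst (λ l → iterate prev l d ≋ e) even (compose-prev m₁ m₂ d→0 0→e)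
    ... | inj₂ (t , odd) = t + q , subst (λ l → iterate prev l d ≋ e) total
            (compose-prev (k + m₁) m₂ (compose-prev m₁ k d→0 prev-order) 0→e)
      where
      regroup₁ : ∀ a b q → b + ((2 * q + 1) + a) ≡ suc (b + a) + (q + q)
      regroup₁ = solve-∀
      regroup₂ : ∀ t q → (t + t) + (q + q) ≡ (t + q) + (t + q)
      regroup₂ = solve-∀
      total : m₂ + (k + m₁) ≡ (t + q) + (t + q)
      total = trans (cong (λ k → m₂ + (k + m₁)) k≡2q+1)
                    (trans (regroup₁ m₁ m₂ q) (trans (cong (_+ (q + q)) odd) (regroup₂ t q)))

  module AlongDiagonal (coprime-gap : ∀ {d} → diag d ≡ true → Coprime n (gap d)) where

    no-early-wrap : ∀ {d} → diag d ≡ true → ∀ m → suc m < n → (m * gap d + gap d) % n ≢ 0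
    no-early-wrap {d} hd m 1+m<n ≡0 = <⇒≱ 1+m<n (∣⇒≤ n∣1+m)
      where
      n∣1+m : n ∣ suc m
      n∣1+m = coprime-divisor (coprime-gap hd) (m%n≡0⇒n∣m _ n (trans (cong (_% n) multiple) ≡0))
        where
        multiple : gap d * suc m ≡ m * gap d + gap d
        multiple = trans (*-comm (gap d) (suc m)) (+-comm (gap d) (m * gap d))

    walk : ∀ {d} → diag d ≡ true → ∀ m → m < n → iterate S m (cell d 0) ≡ cell d (m * gap d)
    walk hd zero _ = refl
    walk {d} hd (suc m) 1+m<n = begin
      S (iterate S m (cell d 0))   ≡⟨ cong S (walk hd m (<⇒≤ 1+m<n)) ⟩
      S (cell d (m * gap d))       ≡⟨ move-along (m * gap d) hd (no-early-wrap hd m 1+m<n) ⟩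
      cell d (m * gap d + gap d)   ≡⟨ cong (cell d) (+-comm (m * gap d) (gap d)) ⟩
      cell d (suc m * gap d)       ∎
      where open ≡-Reasoning

    walk-round : ∀ {d} → diag d ≡ true → iterate S n (cell d 0) ≡ cell (prev (prev d)) 0
    walk-round {d} hd = begin
      iterate S n (cell d 0)                ≡⟨ cong (λ m → iterate S m (cell d 0)) (sym 1+n-1) ⟩
      S (iterate S (n ∸ 1) (cell d 0))      ≡⟨ cong S (walk hd (n ∸ 1) (subst (n ∸ 1 <_) 1+n-1 ≤-refl)) ⟩
      S (cell d ((n ∸ 1) * gap d))          ≡⟨ move-wrap _ hd wraps ⟩
      cell (prev (prev d)) ((n ∸ 1) * gap d + gap d) ≡⟨ cell-≋ refl (trans wraps (sym 0%n)) ⟩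
      cell (prev (prev d)) 0                ∎
      where
      open ≡-Reasoning
      1+n-1 : suc (n ∸ 1) ≡ n
      1+n-1 = m+[n∸m]≡n (>-nonZero⁻¹ n)
      wraps : ((n ∸ 1) * gap d + gap d) % n ≡ 0
      wraps = trans (cong (_% n) (trans (+-comm _ (gap d)) (trans (cong (_* gap d) 1+n-1)
                                                                   (*-comm n (gap d)))))
                    (m*n%n≡0 (gap d) n)

    gap-inverse : ∀ {d} → diag d ≡ true → ∃ λ a → a * gap d ≋ 1
    gap-inverse {d} hd with coprime-Bézout (coprime-gap hd)
    ... | Bézout.-+ x y 1+xn≡yg = y , trans (cong (_% n) (sym 1+xn≡yg)) ([m+kn]%n≡m%n 1 x n)
    ... | Bézout.+- x y 1+yg≡xn = (n ∸ 1) * y , ≋-cancelˡ (n ∸ 1) (begin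
      ((n ∸ 1) + (n ∸ 1) * y * g) % n   ≡⟨ cong (_% n) (factor (n ∸ 1) y g) ⟩
      ((n ∸ 1) * (1 + y * g)) % n       ≡⟨ cong (λ t → ((n ∸ 1) * t) % n) 1+yg≡xn ⟩
      ((n ∸ 1) * (x * n)) % n           ≡⟨ cong (_% n) (sym (*-assoc (n ∸ 1) x n)) ⟩
      ((n ∸ 1) * x * n) % n             ≡⟨ m*n%n≡0 ((n ∸ 1) * x) n ⟩
      0                                 ≡⟨ n%n≡0 n ⟨
      n % n                             ≡⟨ cong (_% n) (m∸n+n≡m (>-nonZero⁻¹ n)) ⟨
      ((n ∸ 1) + 1) % n                 ∎)
      where
      open ≡-Reasoning
      g = gap d
      factor : ∀ a y g → a + a * y * g ≡ a * (1 + y * g)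
      factor = solve-∀

    gap-multiple : ∀ {d} → diag d ≡ true → ∀ j → ∃ λ m → m < n × m * gap d ≋ j
    gap-multiple {d} hd j with gap-inverse hd
    ... | a , ag≋1 = (j * a) % n , m%n<n (j * a) n , (begin
      ((j * a) % n * gap d) % n   ≡⟨ ≋-* (%≋ (j * a)) refl ⟩
      (j * a * gap d) % n         ≡⟨ cong (_% n) (*-assoc j a (gap d)) ⟩
      (j * (a * gap d)) % n       ≡⟨ ≋-* {j} {j} refl ag≋1 ⟩
      (j * 1) % n                 ≡⟨ cong (_% n) (*-identityʳ j) ⟩
      j % n                       ∎)
      where open ≡-Reasoning

    reach-along : ∀ {d} → diag d ≡ true → ∀ j → Reaches (cell d 0) (cell d j)
    reach-along hd j with gap-multiple hd j
    ... | m , m<n , mg≋j = m , trans (walk hd m m<n) (cell-≋ refl mg≋j)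

    reach-next : ∀ {d} → diag d ≡ true → ∀ j → Reaches (cell d j) (cell (prev (prev d)) 0)
    reach-next {d} hd j with gap-multiple hd j
    ... | m , m<n , mg≋j = n ∸ m , (begin
      iterate S (n ∸ m) (cell d j)                   ≡⟨ cong (iterate S (n ∸ m)) (cell-≋ refl (sym mg≋j)) ⟩
      iterate S (n ∸ m) (cell d (m * gap d))         ≡⟨ cong (iterate S (n ∸ m)) (walk hd m m<n) ⟨
      iterate S (n ∸ m) (iterate S m (cell d 0))     ≡⟨ iterate-+ S (n ∸ m) m _ ⟨
      iterate S (n ∸ m + m) (cell d 0)               ≡⟨ cong (λ t → iterate S t (cell d 0)) (m∸n+n≡m (<⇒≤ m<n)) ⟩
      iterate S n (cell d 0)                         ≡⟨ walk-round hd ⟩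
      cell (prev (prev d)) 0                         ∎)
      where open ≡-Reasoning

    -- Each pass along a diagonal descends two filled diagonals.
    reach-even : ∀ t {d} → diag d ≡ true → Reaches (cell d 0) (cell (iterate prev (t + t) d) 0)
    reach-even zero hd = 0 , refl
    reach-even (suc t) {d} hd = reaches-trans (reach-even t hd)
      (subst (λ l → Reaches (cell (iterate prev (t + t) d) 0) (cell (iterate prev l d) 0)) 2+2t
             (reach-next (iterate-prev-filled (t + t) hd) 0))
      where
      2+2t : suc (suc (t + t)) ≡ suc t + suc t
      2+2t = cong suc (sym (+-suc t t))

  on-diagonal : ∀ (i j : Fin n) → down (toℕ i) (toℕ j) + toℕ j ≋ toℕ i
  on-diagonal i j = down-+ (toℕ i) (<⇒≤ (FinP.toℕ<n j))

  cell-of : ∀ (i j : Fin n) → (i , j) ≡ cell (down (toℕ i) (toℕ j)) (toℕ j)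
  cell-of i j = cong₂ _,_ (trans (sym (toF-toℕ i)) (toF-≋ (sym (on-diagonal i j)))) (sym (toF-toℕ j))

  filled-diag : ∀ {i j} → A i j ≡ true → diag (down (toℕ i) (toℕ j)) ≡ true
  filled-diag {i} {j} filled =
    trans (sym (A-on _ (on-diagonal i j))) (trans (cong₂ A (toF-toℕ i) (toF-toℕ j)) filled)

  -- If all gaps are coprime to n and an odd number k of diagonals, including 0, is
  -- filled, then S is a single cycle: from (i, j) it runs to column 0 two filled
  -- diagonals lower, descends evenly to the diagonal of (i′, j′) and runs along it.
  single-cycle : (∀ {d} → diag d ≡ true → Coprime n (gap d)) →
                 ∀ k → ∣ D ∣ ≡ k → Odd k → diag 0 ≡ true → IsSolution A allPlus firstMinus
  single-cycle coprime-gap k size odd d0 (i , j) (i′ , j′) hx hy =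
    subst₂ Reaches (sym (cell-of i j)) (sym (cell-of i′ j′)) route
    where
    open Counting k size d0
    open AlongDiagonal coprime-gap
    dx = down (toℕ i) (toℕ j)
    dy = down (toℕ i′) (toℕ j′)
    hdx = filled-diag hx
    hdy = filled-diag hy
    hstart : diag (prev (prev dx)) ≡ true
    hstart = prev-filled (prev-filled hdx)
    route : Reaches (cell dx (toℕ j)) (cell dy (toℕ j′))
    route with even-descent odd hstart hdy
    ... | t , arrives = reaches-trans (reach-next hdx (toℕ j))
      (reaches-trans (reach-even t hstart)
        (subst (λ c → Reaches c (cell dy (toℕ j′))) (cell-≋ (sym arrives) refl)
               (reach-along hdy (toℕ j′))))

  filled⇒DiagFilled : ∀ {e} → diag e ≡ true → DiagFilled A (toF e)
  filled⇒DiagFilled he t = trans (onDiagonals _ t) he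

  empty⇒DiagEmpty : ∀ {e} → diag e ≡ false → DiagEmpty A (toF e)
  empty⇒DiagEmpty he t = trans (onDiagonals _ t) he

  DiagFilled⇒filled : ∀ {e} → DiagFilled A (toF e) → diag e ≡ true
  DiagFilled⇒filled {e} filled = trans (sym (onDiagonals (toF e) (toF 0))) (filled (toF 0))

  -- Below a filled d lie gap d - 1 empty diagonals and then the filled prev d, so
  -- for an array of width s every gap is 1 (no strip) or s + 1.
  gap-width : ∀ {s d} → HasWidth s A → diag d ≡ true → gap d ≡ 1 ⊎ gap d ≡ suc s
  gap-width {s} {d} width hd with gap d ≟ 1
  ... | yes g≡1 = inj₁ g≡1
  ... | no g≢1 = inj₂ (trans (sym 1+t) (cong suc (width (toF (prev d)) t 1≤t lower strip upper)))
    where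
    open FirstHit (gap-spec hd)
    t = gap d ∸ 1
    1+t : suc t ≡ gap d
    1+t = m+[n∸m]≡n lo
    1≤t : 1 ≤ t
    1≤t = ∸-monoˡ-≤ 1 (≤∧≢⇒< lo (λ 1≡g → g≢1 (sym 1≡g)))
    lower : DiagFilled A (toF (prev d))
    lower = filled⇒DiagFilled hit
    strip : ∀ u → 1 ≤ u → u ≤ t → DiagEmpty A (toF (prev d) ⊕ u)
    strip u 1≤u u≤t = subst (DiagEmpty A) (sym (⊕-toF (prev d) u))
      (empty⇒DiagEmpty (trans (cong diag (down-∸ d hi (<⇒≤ u<g)))
                              (miss (gap d ∸ u) (m<n⇒0<n∸m u<g) (∸-monoʳ-< 1≤u (<⇒≤ u<g)))))
      where
      u<g : u < gap d
      u<g = subst (u <_) 1+t (s≤s u≤t)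
    upper : DiagFilled A (toF (prev d) ⊕ suc t)
    upper = subst (DiagFilled A) (sym (⊕-toF (prev d) (suc t)))
      (filled⇒DiagFilled (trans (diag-≋ (subst (λ g → prev d + g ≋ d) (sym 1+t) (down-+ d hi))) hd))

  coprime-gaps : ∀ {s} → HasWidth s A → Coprime n (suc s) → ∀ {d} → diag d ≡ true → Coprime n (gap d)
  coprime-gaps width n⊥1+s hd with gap-width width hd
  ... | inj₁ g≡1 = subst (Coprime n) (sym g≡1) (Coprimality.sym (1-coprimeTo n))
  ... | inj₂ g≡1+s = subst (Coprime n) (sym g≡1+s) n⊥1+s

-- n = 2(s + 1) + (k - 2), so a common divisor of n and s + 1 divides gcd(n, k - 2).
width-coprime : ∀ {k n s} → 2 ≤ k → k ≤ n → n ∸ k ≡ 2 * s → gcd n (k ∸ 2) ≡ 1 → Coprime n (suc s)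
width-coprime {k} {n} {s} 2≤k k≤n n-k≡2s gcd≡1 {c} (c∣n , c∣1+s) =
  ∣1⇒≡1 (subst (c ∣_) gcd≡1 (gcd-greatest c∣n c∣k-2))
  where
  regroup : ∀ a s → 2 + a + 2 * s ≡ 2 * suc s + a
  regroup = solve-∀
  n≡ : n ≡ 2 * suc s + (k ∸ 2)
  n≡ = begin
    n                         ≡⟨ m+[n∸m]≡n k≤n ⟨
    k + (n ∸ k)               ≡⟨ cong₂ _+_ (m+[n∸m]≡n 2≤k) (sym n-k≡2s) ⟨
    2 + (k ∸ 2) + 2 * s       ≡⟨ regroup (k ∸ 2) s ⟩
    2 * suc s + (k ∸ 2)       ∎
    where open ≡-Reasoning
  c∣k-2 : c ∣ k ∸ 2
  c∣k-2 = ∣m+n∣m⇒∣n (subst (c ∣_) n≡ c∣n) (∣n⇒∣m*n 2 c∣1+s)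

corollary4p20 : (k n s : ℕ) .{{_ : NonZero n}} → 3 ≤ k → Odd k → k < n →
    (A : Array n) → KDiagonal k A → n ∸ k ≡ 2 * s → HasWidth s A →
    StandardForm A → gcd n (k ∸ 2) ≡ 1 →
    IsSolution A allPlus firstMinus
corollary4p20 k n s 3≤k odd k<n A (D , size , onDiagonals) n-k≡2s width (D₁-filled , _) gcd≡1 =
  single-cycle (coprime-gaps width (width-coprime (<⇒≤ 3≤k) (<⇒≤ k<n) n-k≡2s gcd≡1))
               k size odd (DiagFilled⇒filled D₁-filled)
  where open DiagonalArray n A D onDiagonals
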